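{- Let $\alpha=(\alpha_1,\dots,\alpha_l)\in\mathcal{P}(n)$ with $\delta(\alpha)=(d_k)_{k\ge1}$. Then for every $k\ge1$: (1) $d_{k+1}-d_k\le 1$, with equality if and only if $d_j=j$ for all $1\le j\le k+1$; (2) if $d_k\ge d_{k+1}$, then $d_{k+1}\ge d_{k+2}$.
   Context: $\mathcal{P}(n)$ is the set of partitions $\alpha=(\alpha_1\ge\dots\ge\alpha_l\ge1)$ of the positive integer $n$, with $\alpha_i=0$ for $i>l$. The diagonal sequence of $\alpha$ is $\delta(\alpha)=(d_k)_{k\ge1}$ with $d_k=\big|\{i:1\le i\le k,\ \alpha_i+i-1\ge k\}\big|$. -}

module Defs where

open import Data.Nat using (ℕ; zero; suc; _+_; _∸_; _≤_; _≥_; _≤?_)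
open import Data.List using (List; []; _∷_; length; filter; map; upTo)
open import Data.Nat.ListAction using (sum)
open import Data.List.Relation.Unary.All using (All)
open import Data.List.Relation.Unary.Linked using (Linked)
open import Data.Product using (_×_)
open import Relation.Binary.PropositionalEquality using (_≡_)

IsPartition : ℕ → List ℕ → Set
IsPartition n α = All (1 ≤_) α × Linked _≥_ α × sum α ≡ n

-- entry α i = α_i (1-indexed), with α_i = 0 for i > l (and for i = 0, unused).
entry : List ℕ → ℕ → ℕ
entry []       _             = 0
entry (x ∷ xs) zero          = 0
entry (x ∷ xs) (suc zero)    = x
entry (x ∷ xs) (suc (suc i)) = entry xs (suc i)

diag : List ℕ → ℕ → ℕ
diag α k = length (filter (λ i → k ≤? entry α i + i ∸ 1) (map suc (upTo k)))

-- Put a_i = α_i + i − 1, so that d_k = #{i ≤ k : a_i ≥ k}; since α is weakly decreasing,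
-- a_{i+1} ≤ a_i + 1. Passing from d_k to d_{k+1} loses the indices i ≤ k with a_i = k and gains
-- at most the index k + 1, so d_{k+1} ≤ d_k + 1. Equality means that nothing is lost and that
-- a_{k+1} ≥ k + 1; a sequence rising by at most one per step cannot climb from below k to k + 1
-- without taking the value k, so then a_i ≥ k + 1 for all i ≤ k + 1, i.e. d_j = j for j ≤ k + 1.
-- For (2), if d_{k+2} gains the index k + 2 then a_{k+1} ≥ k + 1, and d_{k+1} ≤ d_k forces a loss,
-- some i ≤ k with a_i = k; on its way from a_i = k up to a_{k+1} the sequence takes the value k + 1
-- at some index, and that index is lost from d_{k+1} to d_{k+2}.
module Submission where

open import Defs
open import Data.Nat using (ℕ; zero; suc; _+_; _∸_; _≤_; _<_; _≥_; _≤?_; z≤n; s≤s)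
open import Data.Nat.Properties
open import Data.List using (List; []; _∷_; [_]; _++_; length; filter; map; upTo)
open import Data.List.Properties using (length-map; length-upTo; length-++; upTo-∷ʳ; map-++; filter-++; filter-accept; filter-reject; filter-all)
open import Data.List.Membership.Propositional using (_∈_; find; lose)
open import Data.List.Membership.Propositional.Properties using (∈-map⁺; ∈-map⁻; ∈-upTo⁺; ∈-upTo⁻)
open import Data.List.Relation.Unary.All using (tabulate)
open import Data.List.Relation.Unary.Any using (Any; here; there)
open import Data.List.Relation.Unary.Linked using (Linked; []; [-]; _∷_)
open import Data.Product using (_×_; _,_; ∃-syntax)
open import Data.Sum using (inj₁; inj₂)
open import Function.Bundles using (_⇔_; mk⇔)
open import Relation.Nullary using (¬_; yes; no; contradiction)
open import Relation.Unary using (Decidable; _⊆_; _∩_; ∁)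
open import Relation.Binary.PropositionalEquality using (_≡_; refl; sym; trans; cong; module ≡-Reasoning)

module _ {A : Set} {P Q : A → Set} (P? : Decidable P) (Q? : Decidable Q) where

  length-filter-mono : P ⊆ Q → ∀ xs → length (filter P? xs) ≤ length (filter Q? xs)
  length-filter-mono P⊆Q [] = z≤n
  length-filter-mono P⊆Q (x ∷ xs) with P? x | Q? x
  ... | yes _  | yes _  = s≤s (length-filter-mono P⊆Q xs)
  ... | yes px | no ¬qx = contradiction (P⊆Q px) ¬qx
  ... | no _   | yes _  = m≤n⇒m≤1+n (length-filter-mono P⊆Q xs)
  ... | no _   | no _   = length-filter-mono P⊆Q xs

  length-filter-<⁺ : P ⊆ Q → ∀ {xs} → Any (Q ∩ ∁ P) xs → length (filter P? xs) < length (filter Q? xs)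
  length-filter-<⁺ P⊆Q {x ∷ xs} (here (qx , ¬px)) with P? x | Q? x
  ... | yes px | _      = contradiction px ¬px
  ... | no _   | yes _  = s≤s (length-filter-mono P⊆Q xs)
  ... | no _   | no ¬qx = contradiction qx ¬qx
  length-filter-<⁺ P⊆Q {x ∷ xs} (there any) with P? x | Q? x
  ... | yes _  | yes _  = s≤s (length-filter-<⁺ P⊆Q any)
  ... | yes px | no ¬qx = contradiction (P⊆Q px) ¬qx
  ... | no _   | yes _  = m<n⇒m<1+n (length-filter-<⁺ P⊆Q any)
  ... | no _   | no _   = length-filter-<⁺ P⊆Q any

  length-filter-<⁻ : ∀ xs → length (filter P? xs) < length (filter Q? xs) → Any (Q ∩ ∁ P) xs
  length-filter-<⁻ (x ∷ xs) lt with P? x | Q? x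
  ... | yes _ | yes _  = there (length-filter-<⁻ xs (≤-pred lt))
  ... | yes _ | no _   = there (length-filter-<⁻ xs (<⇒≤ lt))
  ... | no ¬px | yes qx = here (qx , ¬px)
  ... | no _  | no _   = there (length-filter-<⁻ xs lt)

[1…_] : ℕ → List ℕ
[1… m ] = map suc (upTo m)

length-[1…] : ∀ m → length [1… m ] ≡ m
length-[1…] m = trans (length-map suc (upTo m)) (length-upTo m)

[1…]-suc : ∀ m → [1… suc m ] ≡ [1… m ] ++ [ suc m ]
[1…]-suc m = trans (cong (map suc) (sym (upTo-∷ʳ m))) (map-++ suc (upTo m) [ m ])

∈-[1…]⁺ : ∀ {i m} → 1 ≤ i → i ≤ m → i ∈ [1… m ]
∈-[1…]⁺ {suc i} _ i<m = ∈-map⁺ suc (∈-upTo⁺ i<m)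

∈-[1…]⁻ : ∀ {i m} → i ∈ [1… m ] → 1 ≤ i × i ≤ m
∈-[1…]⁻ i∈ with _ , j∈ , refl ← ∈-map⁻ suc i∈ = s≤s z≤n , ∈-upTo⁻ j∈

count : ℕ → (ℕ → ℕ) → ℕ → ℕ
count t a m = length (filter (λ i → t ≤? a i) [1… m ])

diagonal : (ℕ → ℕ) → ℕ → ℕ
diagonal a k = count k a k

module _ (a : ℕ → ℕ) where

  count-suc : ∀ t m → count t a (suc m) ≡ count t a m + length (filter (λ i → t ≤? a i) [ suc m ])
  count-suc t m = begin
      length (filter t≤a? [1… suc m ])
    ≡⟨ cong (λ is → length (filter t≤a? is)) ([1…]-suc m) ⟩
      length (filter t≤a? ([1… m ] ++ [ suc m ]))
    ≡⟨ cong length (filter-++ t≤a? [1… m ] [ suc m ]) ⟩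
      length (filter t≤a? [1… m ] ++ filter t≤a? [ suc m ])
    ≡⟨ length-++ (filter t≤a? [1… m ]) ⟩
      count t a m + length (filter t≤a? [ suc m ]) ∎
    where
      open ≡-Reasoning
      t≤a? : Decidable (λ i → t ≤ a i)
      t≤a? i = t ≤? a i

  count-suc-accept : ∀ {t m} → t ≤ a (suc m) → count t a (suc m) ≡ suc (count t a m)
  count-suc-accept {t} {m} t≤a = trans (count-suc t m)
    (trans (cong (λ xs → count t a m + length xs) (filter-accept (λ i → t ≤? a i) t≤a)) (+-comm _ 1))

  count-suc-reject : ∀ {t m} → ¬ t ≤ a (suc m) → count t a (suc m) ≡ count t a m
  count-suc-reject {t} {m} t≰a = trans (count-suc t m)
    (trans (cong (λ xs → count t a m + length xs) (filter-reject (λ i → t ≤? a i) t≰a)) (+-identityʳ _))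

  count-suc-≤ : ∀ t m → count t a (suc m) ≤ suc (count t a m)
  count-suc-≤ t m with t ≤? a (suc m)
  ... | yes t≤a = ≤-reflexive (count-suc-accept t≤a)
  ... | no t≰a  = m≤n⇒m≤1+n (≤-reflexive (count-suc-reject t≰a))

  count-full : ∀ {t m} → (∀ {i} → 1 ≤ i → i ≤ m → t ≤ a i) → count t a m ≡ m
  count-full {t} {m} t≤a = trans
    (cong length (filter-all (λ i → t ≤? a i) (tabulate (λ i∈ → let 1≤i , i≤m = ∈-[1…]⁻ i∈ in t≤a 1≤i i≤m))))
    (length-[1…] m)

  count-antitone : ∀ t m → count (suc t) a m ≤ count t a m
  count-antitone _ m = length-filter-mono _ _ <⇒≤ [1… m ]

  count-<⁺ : ∀ {t m i} → 1 ≤ i → i ≤ m → a i ≡ t → count (suc t) a m < count t a m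
  count-<⁺ 1≤i i≤m refl = length-filter-<⁺ _ _ <⇒≤
    (lose (∈-[1…]⁺ 1≤i i≤m) (≤-refl , <-irrefl refl))

  count-<⁻ : ∀ {t m} → count (suc t) a m < count t a m → ∃[ i ] 1 ≤ i × i ≤ m × a i ≡ t
  count-<⁻ {t} {m} lt with i , i∈ , t≤a , st≰a ← find (length-filter-<⁻ _ _ [1… m ] lt) =
    let 1≤i , i≤m = ∈-[1…]⁻ i∈ in i , 1≤i , i≤m , ≤-antisym (≮⇒≥ st≰a) t≤a

  diagonal-suc-≤ : ∀ k → diagonal a (suc k) ≤ suc (diagonal a k)
  diagonal-suc-≤ k = ≤-trans (count-suc-≤ (suc k) k) (s≤s (count-antitone k k))

IncreasesByAtMostOne : (ℕ → ℕ) → Set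
IncreasesByAtMostOne a = ∀ {i} → 1 ≤ i → a (suc i) ≤ suc (a i)

module _ {a : ℕ → ℕ} (slow : IncreasesByAtMostOne a) where

  upcrossing : ∀ {t i m} → 1 ≤ i → i ≤ m → a i ≤ t → suc t ≤ a m →
             ∃[ j ] i ≤ j × j < m × a j ≡ t × a (suc j) ≡ suc t
  upcrossing {m = zero} (s≤s _) ()
  upcrossing {t} {i} {suc m} 1≤i i≤m ai≤t t<am with m≤n⇒m<n∨m≡n i≤m
  ... | inj₂ refl = contradiction ai≤t (<⇒≱ t<am)
  ... | inj₁ (s≤s i≤m-1) with suc t ≤? a m
  ...   | yes t<am-1 with j , i≤j , j<m-1 , aj≡t , asj≡st ← upcrossing 1≤i i≤m-1 ai≤t t<am-1 =
          j , i≤j , m<n⇒m<1+n j<m-1 , aj≡t , asj≡st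
  ...   | no t≮am-1 =
          m , i≤m-1 , ≤-refl , am-1≡t , ≤-antisym (≤-trans (slow 1≤m-1) (s≤s (≤-reflexive am-1≡t))) t<am
    where
      1≤m-1 : 1 ≤ m
      1≤m-1 = ≤-trans 1≤i i≤m-1

      am-1≡t : a m ≡ t
      am-1≡t = ≤-antisym (≮⇒≥ t≮am-1) (≤-pred (≤-trans t<am (slow 1≤m-1)))

  diagonal-suc-≡⇒ : ∀ {k} → diagonal a (suc k) ≡ suc (diagonal a k) →
                    ∀ j → 1 ≤ j → j ≤ suc k → diagonal a j ≡ j
  diagonal-suc-≡⇒ {k} jump _ _ j≤sk =
    count-full a (λ 1≤i i≤j → ≤-trans j≤sk (above 1≤i (≤-trans i≤j j≤sk)))
    where
      sk≤ask : suc k ≤ a (suc k)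
      sk≤ask with suc k ≤? a (suc k)
      ... | yes sk≤ask = sk≤ask
      ... | no sk≰ask = contradiction (trans (sym (count-suc-reject a sk≰ask)) jump)
                                      (<⇒≢ (s≤s (count-antitone a k k)))

      no-drop : count (suc k) a k ≡ diagonal a k
      no-drop = suc-injective (trans (sym (count-suc-accept a sk≤ask)) jump)

      above : ∀ {i} → 1 ≤ i → i ≤ suc k → suc k ≤ a i
      above {i} 1≤i i≤sk with suc k ≤? a i
      ... | yes sk≤ai = sk≤ai
      ... | no sk≰ai with j , i≤j , j<sk , aj≡k , _ ← upcrossing 1≤i i≤sk (≮⇒≥ sk≰ai) sk≤ask =
            contradiction no-drop (<⇒≢ (count-<⁺ a (≤-trans 1≤i i≤j) (≤-pred j<sk) aj≡k))

  diagonal-decrease-persists : ∀ {k} → diagonal a (suc k) ≤ diagonal a k →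
                               diagonal a (suc (suc k)) ≤ diagonal a (suc k)
  diagonal-decrease-persists {k} dsk≤dk with suc (suc k) ≤? a (suc (suc k))
  ... | no ssk≰a = ≤-trans (≤-reflexive (count-suc-reject a ssk≰a)) (count-antitone a (suc k) (suc k))
  ... | yes ssk≤a = ≤-trans (≤-reflexive (count-suc-accept a ssk≤a)) drop
    where
      sk≤ask : suc k ≤ a (suc k)
      sk≤ask = ≤-pred (≤-trans ssk≤a (slow (s≤s z≤n)))

      drop : count (suc (suc k)) a (suc k) < diagonal a (suc k)
      drop with i , 1≤i , i≤k , ai≡k ← count-<⁻ a (≤-trans (≤-reflexive (sym (count-suc-accept a sk≤ask))) dsk≤dk)
           with j , _ , j<sk , _ , asj≡sk ← upcrossing 1≤i (m≤n⇒m≤1+n i≤k) (≤-reflexive ai≡k) sk≤ask =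
        count-<⁺ a (s≤s z≤n) j<sk asj≡sk

-- d_k counts the cells (i , j) of α with i + j − 1 = k, and row i contains such a cell iff reach α i ≥ k.
reach : List ℕ → ℕ → ℕ
reach α i = entry α i + i ∸ 1

entry-suc-≤ : ∀ {α} → Linked _≥_ α → ∀ i → entry α (suc (suc i)) ≤ entry α (suc i)
entry-suc-≤ []               _       = z≤n
entry-suc-≤ [-]              _       = z≤n
entry-suc-≤ (x≥y ∷ _)        zero    = x≥y
entry-suc-≤ (_ ∷ decreasing) (suc i) = entry-suc-≤ decreasing i

reach-suc : ∀ α i → reach α (suc i) ≡ entry α (suc i) + i
reach-suc α i = cong (_∸ 1) (+-suc (entry α (suc i)) i)

reach-increasesByAtMostOne : ∀ {α} → Linked _≥_ α → IncreasesByAtMostOne (reach α)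
reach-increasesByAtMostOne {α} decreasing {suc i} _ = begin
  reach α (suc (suc i))             ≡⟨ reach-suc α (suc i) ⟩
  entry α (suc (suc i)) + suc i     ≤⟨ +-monoˡ-≤ (suc i) (entry-suc-≤ decreasing i) ⟩
  entry α (suc i) + suc i           ≡⟨ +-suc (entry α (suc i)) i ⟩
  suc (entry α (suc i) + i)         ≡⟨ cong suc (sym (reach-suc α i)) ⟩
  suc (reach α (suc i))             ∎
  where open ≤-Reasoning

lemma2p1 : (n : ℕ) → 1 ≤ n → (α : List ℕ) → IsPartition n α → (k : ℕ) → 1 ≤ k →
    (diag α (suc k) ≤ suc (diag α k)
      × (diag α (suc k) ≡ suc (diag α k) ⇔ ((j : ℕ) → 1 ≤ j → j ≤ suc k → diag α j ≡ j)))
    × (diag α (suc k) ≤ diag α k → diag α (suc (suc k)) ≤ diag α (suc k))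
lemma2p1 _ _ α (_ , decreasing , _) k 1≤k =
  ( diagonal-suc-≤ (reach α) k
  , mk⇔ (diagonal-suc-≡⇒ slow)
        (λ diagonal≡id → trans (diagonal≡id (suc k) (s≤s z≤n) ≤-refl)
                               (cong suc (sym (diagonal≡id k 1≤k (n≤1+n k))))))
  , diagonal-decrease-persists slow
  where
    slow : IncreasesByAtMostOne (reach α)
    slow = reach-increasesByAtMostOne decreasing
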